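{- Let $T$ be a proper subtree of $L_{n,k}$ and let $U\subset V_{k-1}(T)$. Then there is at most one complete matching of $T$ whose set of covered vertices is exactly $V_k(T)\cup U$.
   Context: $L_{n,k}$ is the bipartite graph with vertex classes $\binom{[n]}{k+1}$ and $\binom{[n]}{k}$ (sets of subsets of $[n]=\{1,\dots,n\}$ of sizes $k+1$ and $k$), with $X\sim Y$ iff $Y\subset X$. For a subgraph $H$, $V_k(H)=V(H)\cap\binom{[n]}{k+1}$ and $V_{k-1}(H)=V(H)\cap\binom{[n]}{k}$. A proper subtree of $L_{n,k}$ is an induced subgraph $T$ of $L_{n,k}$ which is a tree and such that for every $X\in V_k(T)$ all $k+1$ neighbours of $X$ in $L_{n,k}$ lie in $V(T)$. A matching of $T$ is complete if it covers all vertices of $V_k(T)$. -}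

module Defs where

open import Data.Nat using (ℕ; suc; _≤_)
open import Data.Bool using (Bool; true)
open import Data.Fin.Subset using (Subset; ∣_∣; _⊆_)
open import Data.List using (List; []; _∷_; _++_; [_]; length)
open import Data.List.Relation.Unary.Linked using (Linked)
open import Data.List.Relation.Unary.Unique.Propositional using (Unique)
open import Data.Product using (Σ; _×_)
open import Data.Sum using (_⊎_)
open import Relation.Binary.PropositionalEquality using (_≡_)
open import Relation.Nullary using (¬_)

-- A vertex of L_{n,k} is a subset of [n] = Fin n of size k+1 or k.
-- A (vertex set of an) induced subgraph of L_{n,k} is a decidable set of subsets,
-- given as a Bool-valued characteristic function.
VSet : ℕ → Set
VSet n = Subset n → Bool

module _ {n : ℕ} (k : ℕ) (T : VSet n) where

  InL : Set
  InL = ∀ X → T X ≡ true → (∣ X ∣ ≡ suc k) ⊎ (∣ X ∣ ≡ k)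

  InVk : Subset n → Set
  InVk X = (T X ≡ true) × (∣ X ∣ ≡ suc k)

  InVk-1 : Subset n → Set
  InVk-1 Y = (T Y ≡ true) × (∣ Y ∣ ≡ k)

  Edge : Subset n → Subset n → Set
  Edge X Y = InVk X × InVk-1 Y × (Y ⊆ X)

  Adj : Subset n → Subset n → Set
  Adj u v = Edge u v ⊎ Edge v u

  data Walk : Subset n → Subset n → Set where
    here : ∀ {u} → T u ≡ true → Walk u u
    step : ∀ {u w v} → Adj u w → Walk w v → Walk u v

  Connected : Set
  Connected = ∀ u v → T u ≡ true → T v ≡ true → Walk u v

  IsCycle : Subset n → List (Subset n) → Set
  IsCycle x ys = (2 ≤ length ys) × Unique (x ∷ ys) × Linked Adj (x ∷ ys ++ [ x ])

  Acyclic : Set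
  Acyclic = ∀ x ys → ¬ IsCycle x ys

  IsTree : Set
  IsTree = (Σ (Subset n) λ v → T v ≡ true) × Connected × Acyclic

  ProperClosed : Set
  ProperClosed = ∀ X → InVk X → ∀ Y → ∣ Y ∣ ≡ k → Y ⊆ X → T Y ≡ true

  ProperSubtree : Set
  ProperSubtree = InL × IsTree × ProperClosed

  -- a set of edges M (M X Y = true means edge {X,Y}, X the (k+1)-set)
  IsMatching : (Subset n → Subset n → Bool) → Set
  IsMatching M =
    (∀ X Y → M X Y ≡ true → Edge X Y) ×
    (∀ X Y Y′ → M X Y ≡ true → M X Y′ ≡ true → Y ≡ Y′) ×
    (∀ X X′ Y → M X Y ≡ true → M X′ Y ≡ true → X ≡ X′)

  Covered : (Subset n → Subset n → Bool) → Subset n → Set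
  Covered M v = (Σ (Subset n) λ Y → M v Y ≡ true) ⊎ (Σ (Subset n) λ X → M X v ≡ true)

  IsCompleteMatching : (Subset n → Subset n → Bool) → Set
  IsCompleteMatching M = IsMatching M × (∀ X → InVk X → Covered M X)

  CoversExactly : (Subset n → Subset n → Bool) → VSet n → Set
  CoversExactly M U =
    ∀ v → (Covered M v → InVk v ⊎ U v ≡ true) × (InVk v ⊎ U v ≡ true → Covered M v)

-- Suppose M ≠ M′, say XY ∈ M ∖ M′. Then Y is covered by M, hence by M′, through some X′ ≠ X;
-- X′ ∈ V_k(T) is covered by M through some Y′, and X′Y′ ∉ M′ because M′ already matches X′
-- to Y. Iterating gives an infinite walk X Y X′ Y′ … alternating between edges of M ∖ M′ and
-- M′ ∖ M. It never immediately backtracks (X′ ≠ X as XY ∉ M′, and then Y′ ≠ Y as M is a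
-- matching), so since T is finite its first repeated vertex closes a cycle, contradicting
-- that T is a tree.
module Submission where

open import Defs
open import Data.Bool using (Bool; true)
open import Data.Bool.Properties using (⇔→≡)
open import Data.Fin using (Fin; zero; toℕ; combine)
open import Data.Fin.Properties using (2↔Bool; combine-injective; pigeonhole; inj⇒≟)
open import Data.Fin.Subset using (Subset; ∣_∣)
open import Data.List using ([]; _∷_; _++_; [_]; length; applyUpTo)
open import Data.List.Properties using (length-applyUpTo; applyUpTo-∷ʳ)
open import Data.List.Relation.Unary.Linked using (Linked)
import Data.List.Relation.Unary.Linked.Properties as Linked
open import Data.List.Relation.Unary.Unique.Propositional using (Unique)
import Data.List.Relation.Unary.Unique.Propositional.Properties as Unique
open import Data.Nat using (ℕ; zero; suc; _+_; _^_; _<_; _≤_; z≤n; s≤s)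
open import Data.Nat.GeneralisedArithmetic using (fold)
open import Data.Nat.Induction using (<-wellFounded)
open import Data.Nat.Properties
  using (n<1+n; 1+n≢n; +-comm; +-monoˡ-<; m≤n⇒∃[o]m+o≡n; anyUpTo?)
open import Data.Product using (Σ; ∃; ∃₂; _×_; _,_; proj₁; proj₂)
open import Data.Sum using (inj₁; inj₂)
open import Data.Vec using ([]; _∷_)
open import Function using (_∘_; _↣_; Injection; mk↣; mk⇔)
open import Function.Definitions using (Injective)
open import Function.Properties.Inverse using (↔-sym; ↔⇒↣)
open import Induction.WellFounded using (Acc; acc)
open import Level using (Level; _⊔_)
open import Relation.Binary using (Rel; DecidableEquality)
open import Relation.Binary.PropositionalEquality
  using (_≡_; _≢_; refl; sym; trans; cong₂; subst)
open import Relation.Nullary using (yes; no; contradiction)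
open import Relation.Nullary.Decidable using (decidable-stable)
import Data.Bool as Bool

private
  variable
    a r : Level
    A : Set a

bool↣Fin2 : Bool ↣ Fin 2
bool↣Fin2 = ↔⇒↣ (↔-sym 2↔Bool)

subsetCode : ∀ {n} → Subset n → Fin (2 ^ n)
subsetCode []      = zero
subsetCode (b ∷ X) = combine (Injection.to bool↣Fin2 b) (subsetCode X)

subsetCode-injective : ∀ {n} → Injective _≡_ _≡_ (subsetCode {n})
subsetCode-injective {x = []}    {[]}    _  = refl
subsetCode-injective {x = a ∷ X} {b ∷ Y} eq =
  let head≡ , tail≡ = combine-injective _ _ _ _ eq in
  cong₂ _∷_ (Injection.injective bool↣Fin2 head≡) (subsetCode-injective tail≡)

subset↣Fin : ∀ {n} → Subset n ↣ Fin (2 ^ n)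
subset↣Fin = mk↣ subsetCode-injective

module _ {a} {A : Set a} (w : ℕ → A) where

  RepeatsAt : ℕ → Set a
  RepeatsAt c = ∃ λ b → b < c × w b ≡ w c

  InjectiveBelow : ℕ → Set a
  InjectiveBelow c = ∀ {b c′} → b < c′ → c′ < c → w b ≢ w c′

  firstRepeat : DecidableEquality A → ∀ {c} → RepeatsAt c → ∃ λ c → RepeatsAt c × InjectiveBelow c
  firstRepeat _≟_ = go (<-wellFounded _)
    where
    go : ∀ {c} → Acc _<_ c → RepeatsAt c → ∃ λ c → RepeatsAt c × InjectiveBelow c
    go {c} (acc earlier) repeats with anyUpTo? (λ c′ → anyUpTo? (λ b → w b ≟ w c′) c′) c
    ... | yes (c′ , c′<c , repeats′) = go (earlier c′<c) repeats′
    ... | no noEarlierRepeat =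
      c , repeats , λ b<c′ c′<c wb≡wc′ → noEarlierRepeat (_ , c′<c , _ , b<c′ , wb≡wc′)

pigeonhole-ℕ : ∀ {m} → A ↣ Fin m → (w : ℕ → A) → ∃₂ λ i j → i < j × w i ≡ w j
pigeonhole-ℕ {m = m} ι w =
  let i , j , i<j , eq = pigeonhole (n<1+n m) (Injection.to ι ∘ w ∘ toℕ) in
  toℕ i , toℕ j , i<j , Injection.injective ι eq

HasCycle : {A : Set a} → Rel A r → Set (a ⊔ r)
HasCycle R = ∃₂ λ x ys → 2 ≤ length ys × Unique (x ∷ ys) × Linked R (x ∷ ys ++ [ x ])

module _ (R : Rel A r) (w : ℕ → A)
  (walk : ∀ t → R (w t) (w (suc t)))
  (loopless : ∀ t → w t ≢ w (suc t))
  (nonBacktracking : ∀ t → w t ≢ w (suc (suc t))) where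

  -- The segment is indexed as t + b so that shifting it by one step is definitional.
  closedSegment⇒cycle : ∀ b o → InjectiveBelow w (suc o + b) → w (suc o + b) ≡ w b → HasCycle R
  closedSegment⇒cycle b zero          _   closed = contradiction (sym closed) (loopless b)
  closedSegment⇒cycle b (suc zero)    _   closed = contradiction (sym closed) (nonBacktracking b)
  closedSegment⇒cycle b (suc (suc ℓ)) inj closed =
    w b , applyUpTo (segment ∘ suc) (2 + ℓ) , twoOrMore , distinct , linked
    where
    segment : ℕ → A
    segment t = w (t + b)
    twoOrMore : 2 ≤ length (applyUpTo (segment ∘ suc) (2 + ℓ))
    twoOrMore = subst (2 ≤_) (sym (length-applyUpTo (segment ∘ suc) (2 + ℓ))) (s≤s (s≤s z≤n))
    distinct : Unique (applyUpTo segment (3 + ℓ))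
    distinct = Unique.applyUpTo⁺₁ segment (3 + ℓ) λ i<j j<3+ℓ → inj (+-monoˡ-< b i<j) (+-monoˡ-< b j<3+ℓ)
    linked : Linked R (applyUpTo segment (3 + ℓ) ++ [ w b ])
    linked = subst (λ z → Linked R (applyUpTo segment (3 + ℓ) ++ [ z ])) closed
               (subst (Linked R) (sym (applyUpTo-∷ʳ segment (3 + ℓ)))
                 (Linked.applyUpTo⁺₂ segment (4 + ℓ) (walk ∘ (_+ b))))

  nonBacktrackingWalk⇒cycle : ∀ {m} → A ↣ Fin m → HasCycle R
  nonBacktrackingWalk⇒cycle ι
    with i , j , i<j , wi≡wj ← pigeonhole-ℕ ι w
    with c , (b , b<c , wb≡wc) , inj ← firstRepeat w (inj⇒≟ ι) (i , i<j , wi≡wj)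
    with o , refl ← m≤n⇒∃[o]m+o≡n b<c
    rewrite +-comm b o
    = closedSegment⇒cycle b o inj (sym wb≡wc)

interleave : (ℕ → A) → (ℕ → A) → ℕ → A
interleave x y zero    = x 0
interleave x y (suc t) = interleave y (x ∘ suc) t

module _ (R : Rel A r) where

  interleave-consecutive : ∀ {x y} → (∀ i → R (x i) (y i)) → (∀ i → R (y i) (x (suc i))) →
                           ∀ t → R (interleave x y t) (interleave x y (suc t))
  interleave-consecutive xy yx zero    = xy 0
  interleave-consecutive xy yx (suc t) = interleave-consecutive yx (xy ∘ suc) t

  interleave-skip : ∀ {x y} → (∀ i → R (x i) (x (suc i))) → (∀ i → R (y i) (y (suc i))) →
                    ∀ t → R (interleave x y t) (interleave x y (suc (suc t)))
  interleave-skip xx yy zero    = xx 0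
  interleave-skip xx yy (suc t) = interleave-skip yy (xx ∘ suc) t

upper≢lower : ∀ {n k} (X Y : Subset n) → ∣ X ∣ ≡ suc k → ∣ Y ∣ ≡ k → X ≢ Y
upper≢lower _ _ |X| |Y| refl = 1+n≢n (trans (sym |X|) |Y|)

module _ {n k : ℕ} {T : VSet n} where

  private
    Matching : Set
    Matching = Subset n → Subset n → Bool

  matchedFromAbove : ∀ {M : Matching} {Y} → IsMatching k T M → ∣ Y ∣ ≡ k →
                     Covered k T M Y → ∃ λ X → M X Y ≡ true
  matchedFromAbove {Y = Y} (edge , _) |Y| (inj₁ (Z , MYZ)) =
    contradiction refl (upper≢lower Y Y (proj₂ (proj₁ (edge Y Z MYZ))) |Y|)
  matchedFromAbove _ _ (inj₂ matched) = matched

  matchedFromBelow : ∀ {M : Matching} {X} → IsMatching k T M → ∣ X ∣ ≡ suc k →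
                     Covered k T M X → ∃ λ Y → M X Y ≡ true
  matchedFromBelow _ _ (inj₁ matched) = matched
  matchedFromBelow {X = X} (edge , _) |X| (inj₂ (Z , MZX)) =
    contradiction refl (upper≢lower X X |X| (proj₂ (proj₁ (proj₂ (edge Z X MZX)))))

  module _ {U : VSet n} {M M′ : Matching}
    (M-complete : IsCompleteMatching k T M) (M-exact : CoversExactly k T M U)
    (M′-complete : IsCompleteMatching k T M′) (M′-exact : CoversExactly k T M′ U) where

    private
      M-matching : IsMatching k T M
      M-matching = proj₁ M-complete

      M′-matching : IsMatching k T M′
      M′-matching = proj₁ M′-complete

      M-edge : ∀ X Y → M X Y ≡ true → Edge k T X Y
      M-edge = proj₁ M-matching

      M′-edge : ∀ X Y → M′ X Y ≡ true → Edge k T X Y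
      M′-edge = proj₁ M′-matching

      M′-functional : ∀ X Y Y′ → M′ X Y ≡ true → M′ X Y′ ≡ true → Y ≡ Y′
      M′-functional = proj₁ (proj₂ M′-matching)

      M-injective : ∀ X X′ Y → M X Y ≡ true → M X′ Y ≡ true → X ≡ X′
      M-injective = proj₂ (proj₂ M-matching)

    record Disagreement : Set where
      constructor disagreement
      field
        upper lower : Subset n
        inM : M upper lower ≡ true
        notInM′ : M′ upper lower ≢ true

    open Disagreement

    coveredByM′ : ∀ {X Y} → M X Y ≡ true → Covered k T M′ Y
    coveredByM′ {X} {Y} MXY = proj₂ (M′-exact Y) (proj₁ (M-exact Y) (inj₂ (X , MXY)))

    nextNotInM′ : ∀ {X Y X′ Y′} → M X Y ≡ true → M′ X Y ≢ true →
                  M′ X′ Y ≡ true → M X′ Y′ ≡ true → M′ X′ Y′ ≢ true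
    nextNotInM′ {X} {Y} {X′} {Y′} MXY ¬M′XY M′X′Y MX′Y′ M′X′Y′ =
      ¬M′XY (subst (λ Z → M′ Z Y ≡ true) X′≡X M′X′Y)
      where
      MX′Y : M X′ Y ≡ true
      MX′Y = subst (λ Z → M X′ Z ≡ true) (M′-functional X′ Y′ Y M′X′Y′ M′X′Y) MX′Y′
      X′≡X : X′ ≡ X
      X′≡X = M-injective X′ X Y MX′Y MXY

    next : (d : Disagreement) → Σ Disagreement λ d′ → M′ (upper d′) (lower d) ≡ true
    next (disagreement X Y MXY ¬M′XY) =
      let X′ , M′X′Y = matchedFromAbove M′-matching (proj₂ (proj₁ (proj₂ (M-edge X Y MXY)))) (coveredByM′ MXY)
          X′∈Vk      = proj₁ (M′-edge X′ Y M′X′Y)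
          Y′ , MX′Y′ = matchedFromBelow M-matching (proj₂ X′∈Vk) (proj₂ M-complete X′ X′∈Vk)
      in disagreement X′ Y′ MX′Y′ (nextNotInM′ MXY ¬M′XY M′X′Y MX′Y′) , M′X′Y

    module AlternatingWalk (d₀ : Disagreement) where

      disagreements : ℕ → Disagreement
      disagreements = fold d₀ (proj₁ ∘ next)

      uppers lowers : ℕ → Subset n
      uppers = upper ∘ disagreements
      lowers = lower ∘ disagreements

      walk : ℕ → Subset n
      walk = interleave uppers lowers

      M′-back : ∀ i → M′ (uppers (suc i)) (lowers i) ≡ true
      M′-back i = proj₂ (next (disagreements i))

      |uppers| : ∀ i → ∣ uppers i ∣ ≡ suc k
      |uppers| i = proj₂ (proj₁ (M-edge _ _ (inM (disagreements i))))

      |lowers| : ∀ i → ∣ lowers i ∣ ≡ k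
      |lowers| i = proj₂ (proj₁ (proj₂ (M-edge _ _ (inM (disagreements i)))))

      adjacent : ∀ t → Adj k T (walk t) (walk (suc t))
      adjacent = interleave-consecutive (Adj k T)
        (λ i → inj₁ (M-edge _ _ (inM (disagreements i))))
        (λ i → inj₂ (M′-edge _ _ (M′-back i)))

      loopless : ∀ t → walk t ≢ walk (suc t)
      loopless = interleave-consecutive _≢_
        (λ i → upper≢lower _ _ (|uppers| i) (|lowers| i))
        (λ i → upper≢lower _ _ (|uppers| (suc i)) (|lowers| i) ∘ sym)

      uppers-step : ∀ i → uppers i ≢ uppers (suc i)
      uppers-step i eq = notInM′ (disagreements i) (subst (λ Z → M′ Z (lowers i) ≡ true) (sym eq) (M′-back i))

      lowers-step : ∀ i → lowers i ≢ lowers (suc i)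
      lowers-step i eq = uppers-step i (M-injective _ _ _ (inM (disagreements i))
        (subst (λ Z → M (uppers (suc i)) Z ≡ true) (sym eq) (inM (disagreements (suc i)))))

      nonBacktracking : ∀ t → walk t ≢ walk (suc (suc t))
      nonBacktracking = interleave-skip _≢_ uppers-step lowers-step

    disagreement⇒cycle : Disagreement → HasCycle (Adj k T)
    disagreement⇒cycle d = nonBacktrackingWalk⇒cycle (Adj k T) walk adjacent loopless nonBacktracking subset↣Fin
      where open AlternatingWalk d

    M⊆M′ : Acyclic k T → ∀ {X Y} → M X Y ≡ true → M′ X Y ≡ true
    M⊆M′ acyclic {X} {Y} MXY = decidable-stable (M′ X Y Bool.≟ true) λ ¬M′XY →
      let x , ys , cycle = disagreement⇒cycle (disagreement X Y MXY ¬M′XY) in acyclic x ys cycle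

proposition3p1 : ∀ (n k : ℕ) (T : VSet n) → ProperSubtree k T →
    (U : VSet n) → (∀ Y → U Y ≡ true → InVk-1 k T Y) →
    (M M′ : Subset n → Subset n → Bool) →
    IsCompleteMatching k T M → CoversExactly k T M U →
    IsCompleteMatching k T M′ → CoversExactly k T M′ U →
    ∀ X Y → M X Y ≡ M′ X Y
proposition3p1 n k T (_ , (_ , _ , acyclic) , _) U _ M M′ M-complete M-exact M′-complete M′-exact X Y =
  ⇔→≡ (mk⇔ (M⊆M′ M-complete M-exact M′-complete M′-exact acyclic)
            (M⊆M′ M′-complete M′-exact M-complete M-exact acyclic))
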